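{- Let $D\ge 2$ be square-free, $K=\mathbb{Q}(\sqrt D)$, and for $r\ge1$ let $d_r=1+u_D^r+u_D^{ -r}$ and $d_r'=d_r$ if $d_r$ is odd, $d_r'=2d_r$ if $d_r$ is even. Then the multiplicative order of $u_D$ in $(\mathbb{Z}_K/d_r'\mathbb{Z}_K)^\times$ is $3r\frac{d_r'}{d_r}$; that is, it equals $3r$ if $d_r$ is odd and $6r$ if $d_r$ is even.
   Context: Fix the real embedding of $K$ sending $\sqrt D$ to the positive square root of $D$; $u_f$ is the fundamental unit of $\mathbb{Z}_K$ which is $>1$ under this embedding, and $u_D=u_f^2$ if $u_f$ has norm $-1$, $u_D=u_f$ otherwise. The numbers $d_r$ are positive integers. -}

module Defs where

open import Data.Nat as ℕ using (ℕ; _%_; _/_; _∸_; _≡ᵇ_)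
import Data.Nat.Divisibility as ℕD
open import Data.Integer as ℤ using (ℤ; +_; _+_; _*_; _-_; -_; _<_; _≤_)
open import Data.Product using (_×_; _,_; Σ; ∃; ∃-syntax; proj₁)
open import Data.Sum using (_⊎_)
open import Data.Bool using (if_then_else_)
open import Relation.Binary.PropositionalEquality using (_≡_)
open import Relation.Nullary using (¬_)

SquareFree : ℕ → Set
SquareFree D = ∀ (n : ℕ) → (n ℕ.* n) ℕD.∣ D → n ≡ 1

-- The ring of integers Z_K of K = Q(√D) has Z-basis {1, ω} where
--   ω = √D            if D ≢ 1 (mod 4)   (ω² = D)
--   ω = (1 + √D)/2    if D ≡ 1 (mod 4)   (ω² = ω + (D-1)/4)
-- In both cases ω² = t ω + n with (t , n) below.
ωt : ℕ → ℤ
ωt D = if (D % 4) ≡ᵇ 1 then + 1 else + 0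

ωn : ℕ → ℤ
ωn D = if (D % 4) ≡ᵇ 1 then + ((D ∸ 1) / 4) else + D

-- An element a + b ω of Z_K is represented by (a , b).
𝒪 : Set
𝒪 = ℤ × ℤ

module _ (D : ℕ) where

  fromℤ : ℤ → 𝒪
  fromℤ a = (a , + 0)

  one : 𝒪
  one = fromℤ (+ 1)

  _⊕_ : 𝒪 → 𝒪 → 𝒪
  (a , b) ⊕ (c , d) = (a + c , b + d)

  ⊖_ : 𝒪 → 𝒪
  ⊖ (a , b) = (- a , - b)

  _⊗_ : 𝒪 → 𝒪 → 𝒪
  (a , b) ⊗ (c , d) = (a * c + b * d * ωn D , a * d + b * c + b * d * ωt D)

  pow : 𝒪 → ℕ → 𝒪
  pow x ℕ.zero = one
  pow x (ℕ.suc k) = x ⊗ pow x k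

  -- Norm N(a + b ω) = (a + b ω)(a + b ω'), ω' the conjugate of ω
  norm : 𝒪 → ℤ
  norm (a , b) = a * a + ωt D * a * b - ωn D * b * b

  IsUnit : 𝒪 → Set
  IsUnit x = ∃[ y ] (x ⊗ y ≡ one)

  -- Positivity of the real number X + Y √D (X, Y ∈ ℤ, D not a square).
  PosSurd : ℤ → ℤ → Set
  PosSurd X Y =
      (+ 0 ≤ X × + 0 ≤ Y × ¬ (X ≡ + 0 × Y ≡ + 0))
    ⊎ (+ 0 < X × Y < + 0 × Y * Y * + D < X * X)
    ⊎ (X < + 0 × + 0 < Y × X * X < Y * Y * + D)

  -- Under the fixed real embedding (√D ↦ positive root),
  -- 2 (a + b ω) = (2a + t b) + (2 - t) b √D.
  Positive : 𝒪 → Set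
  Positive (a , b) = PosSurd (+ 2 * a + ωt D * b) ((+ 2 - ωt D) * b)

  GreaterThanOne : 𝒪 → Set
  GreaterThanOne x = Positive (x ⊕ (⊖ one))

  IsFundamentalUnit : 𝒪 → Set
  IsFundamentalUnit u =
    IsUnit u × GreaterThanOne u ×
    (∀ v → IsUnit v → ∃[ k ]
        (  v ≡ pow u k ⊎ v ≡ ⊖ (pow u k)
         ⊎ v ⊗ pow u k ≡ one ⊎ v ⊗ pow u k ≡ ⊖ one))

  uD : 𝒪 → 𝒪
  uD uf = if (norm uf ℤ.≟ -[1+0]) .Relation.Nullary.Dec.does then uf ⊗ uf else uf
    where open import Data.Integer using (-[1+_])
          -[1+0] : ℤ
          -[1+0] = -[1+ 0 ]

  _≡_[mod_] : 𝒪 → 𝒪 → ℕ → Set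
  α ≡ β [mod m ] = ∃[ γ ] (α ⊕ (⊖ β) ≡ fromℤ (+ m) ⊗ γ)

  IsMulOrder : ℕ → 𝒪 → ℕ → Set
  IsMulOrder m x k =
    0 ℕ.< k × pow x k ≡ one [mod m ] ×
    (∀ j → 0 ℕ.< j → pow x j ≡ one [mod m ] → k ℕ.≤ j)

evenFactor : ℕ → ℕ
evenFactor d = if (d % 2) ≡ᵇ 0 then 2 else 1

dPrime : ℕ → ℕ
dPrime d = evenFactor d ℕ.* d

{-# OPTIONS --safe #-}
-- Put x = u_D^r. Then x x⁻¹ = 1 and d = 1 + x + x⁻¹, so x is a root of X² − (d − 1)X + 1, whence
-- x³ − 1 = d·x(x − 1) and u_D^{3r} ≡ 1 (mod d). Conversely, if u_D^t ≡ 1 (mod d) with 0 < t < 2r, then d²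
-- divides N(u_D^t − 1) = 2 − Tr(u_D^t). Now N(u_D) = 1 and Tr(u_D) ≥ 3 (from u_f > 1, and when N(u_f) = −1 from
-- Tr(u_f) ≠ 0, as D is square-free), so the traces s_k = Tr(u_D^k) satisfy
-- s_{k+2} = Tr(u_D) s_{k+1} − s_k and increase strictly, so 2 < s_t < s_{2r} = (d − 1)² − 2, which leaves no
-- room for a positive multiple of d². As 3r < 2·2r, a period t < 3r would also give the period 3r − t < 2r.
-- For d = 2e even, x³ + 1 = (d − 2)·x(x + 1) makes u_D^{6r} − 1 divisible by d(d − 2) = 2d(e − 1), while
-- u_D^{3r} ≡ 1 (mod 2d) would force x(x − 1) = 2γ and then 1 = 2((e − 1)x − γ), impossible in ℤ_K.
module Submission where

open import Defs
open import Level using (0ℓ)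
open import Function using (_∘_)
open import Data.Bool using (true; false; T; if_then_else_)
open import Data.Unit using (tt)
open import Data.Empty using (⊥-elim)
open import Data.Sum using (_⊎_; inj₁; inj₂)
open import Data.Product using (_×_; _,_; proj₁; proj₂; ∃-syntax)
open import Data.Product.Properties using (≡-dec)
open import Data.Nat as ℕ using (ℕ; zero; suc; s≤s; z≤n; _%_; _/_; _∸_; _≡ᵇ_)
import Data.Nat.Properties as ℕₚ
import Data.Nat.Divisibility as ℕD
open import Data.Nat.DivMod using (m≡m%n+[m/n]*n; m*n/n≡m)
open import Data.Nat.Tactic.RingSolver using () renaming (solve-∀ to ℕ-solve-∀)
import Data.Integer as ℤ using (NonZero)
open import Data.Integer
  using (ℤ; +_; -[1+_]; _+_; _*_; _-_; -_; ∣_∣; _≤_; _<_; +≤+; nonNegative)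
  renaming (_≟_ to _≟ℤ_)
import Data.Integer.Properties as ℤₚ
open import Data.Integer.Tactic.RingSolver using (solve-∀)
open import Relation.Nullary using (¬_; Dec; yes; no; does)
open import Relation.Binary.PropositionalEquality
  using (_≡_; _≢_; refl; sym; trans; cong; cong₂; subst; subst₂; isEquivalence; module ≡-Reasoning)
open import Algebra.Bundles using (CommutativeRing)
open import Algebra.Structures {A = 𝒪} _≡_ using (IsCommutativeRing)
open import Algebra.Definitions {A = 𝒪} _≡_
open import Algebra.Consequences.Propositional {A = 𝒪}
  using (comm∧idˡ⇒id; comm∧invˡ⇒inv; comm∧distrˡ⇒distrʳ)
open import Algebra.Solver.Ring.AlmostCommutativeRing using (fromCommutativeRing)
import Algebra.Solver.Ring.Simple as RingSolver
import Algebra.Properties.Semiring.Exp as Exp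
import Algebra.Properties.CommutativeSemiring.Exp as CommutativeExp

≤-positive-multiple : ∀ c g → + 0 ≤ c → + 0 < c * g → c ≤ c * g
≤-positive-multiple c g 0≤c 0<cg = begin
  c       ≡⟨ sym (ℤₚ.*-identityʳ c) ⟩
  c * + 1 ≤⟨ ℤₚ.*-monoˡ-≤-nonNeg c ⦃ nonNegative 0≤c ⦄ (ℤₚ.i<j⇒suc[i]≤j 0<g) ⟩
  c * g   ∎
  where
  open ℤₚ.≤-Reasoning
  0<g : + 0 < g
  0<g = ℤₚ.*-cancelˡ-<-nonNeg c ⦃ nonNegative 0≤c ⦄ (subst (_< c * g) (sym (ℤₚ.*-zeroʳ c)) 0<cg)

[n-1]²-4≤n² : ∀ n → (+ n - + 1) * (+ n - + 1) - + 4 ≤ + n * + n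
[n-1]²-4≤n² n = begin
  (+ n - + 1) * (+ n - + 1) - + 4   ≡⟨ expand (+ n) ⟩
  + n * + n - (+ 2 * + n + + 3)     ≡⟨ cong (λ k → + n * + n - k) (sym 2n+3≡) ⟩
  + n * + n - + (2 ℕ.* n ℕ.+ 3)     ≤⟨ ℤₚ.i-j≤i (+ n * + n) (+ (2 ℕ.* n ℕ.+ 3)) ⟩
  + n * + n                         ∎
  where
  open ℤₚ.≤-Reasoning
  2n+3≡ : + (2 ℕ.* n ℕ.+ 3) ≡ + 2 * + n + + 3
  2n+3≡ = trans (ℤₚ.pos-+ (2 ℕ.* n) 3) (cong (_+ + 3) (ℤₚ.pos-* 2 n))
  expand : ∀ m → (m - + 1) * (m - + 1) - + 4 ≡ m * m - (+ 2 * m + + 3)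
  expand = solve-∀

i≢0⇒1≤i*i : ∀ i → i ≢ + 0 → + 1 ≤ i * i
i≢0⇒1≤i*i (+ 0) i≢0 = ⊥-elim (i≢0 refl)
i≢0⇒1≤i*i (+ suc _) _ = +≤+ (s≤s z≤n)
i≢0⇒1≤i*i -[1+ _ ] _ = +≤+ (s≤s z≤n)

i*j≡1⇒i≡±1 : ∀ i j → i * j ≡ + 1 → i ≡ + 1 ⊎ i ≡ -[1+ 0 ]
i*j≡1⇒i≡±1 i j ij≡1 =
  by-abs i (ℕₚ.m*n≡1⇒m≡1 ∣ i ∣ ∣ j ∣ (trans (sym (ℤₚ.abs-* i j)) (cong ∣_∣ ij≡1)))
  where
  by-abs : ∀ i → ∣ i ∣ ≡ 1 → i ≡ + 1 ⊎ i ≡ -[1+ 0 ]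
  by-abs (+ 1) _ = inj₁ refl
  by-abs -[1+ 0 ] _ = inj₂ refl
  by-abs (+ 0) ()
  by-abs (+ suc (suc _)) ()
  by-abs -[1+ suc _ ] ()

1≢i+i : ∀ i → + 1 ≢ i + i
1≢i+i (+ m) 1≡m+m =
  ℕₚ.even≢odd m 0 (sym (trans (ℤₚ.+-injective 1≡m+m) (cong (m ℕ.+_) (sym (ℕₚ.+-identityʳ m)))))
1≢i+i -[1+ _ ] ()

squareFree⇒≢4 : ∀ {D} → 2 ℕ.≤ D → SquareFree D → ∀ q → q * q * + D ≢ + 4
squareFree⇒≢4 {D} 2≤D squareFree q q²D≡4 = excluded ∣ q ∣ ∣q∣²D≡4
  where
  ∣q∣²D≡4 : ∣ q ∣ ℕ.* ∣ q ∣ ℕ.* D ≡ 4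
  ∣q∣²D≡4 = trans (sym (trans (ℤₚ.abs-* (q * q) (+ D)) (cong (ℕ._* D) (ℤₚ.abs-* q q))))
                  (cong ∣_∣ q²D≡4)
  excluded : ∀ m → m ℕ.* m ℕ.* D ≢ 4
  excluded zero ()
  excluded (suc zero) D+0≡4
    with squareFree 2 (ℕD.divides 1 (trans (sym (ℕₚ.+-identityʳ D)) D+0≡4))
  ... | ()
  excluded (suc (suc m)) m²D≡4 = ℕₚ.<-irrefl (sym m²D≡4)
    (ℕₚ.<-≤-trans (ℕₚ.m<m+n 4 ℕ.z<s) (ℕₚ.*-mono-≤ (ℕₚ.*-mono-≤ 2≤m+2 2≤m+2) 2≤D))
    where
    2≤m+2 : 2 ℕ.≤ suc (suc m)
    2≤m+2 = s≤s (s≤s z≤n)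

module Lucas {s : ℕ → ℤ} {τ : ℤ} (τ≥2 : + 2 ≤ τ) (s₀≥0 : + 0 ≤ s 0) (s₀<s₁ : s 0 < s 1)
             (recurrence : ∀ k → s (suc (suc k)) ≡ τ * s (suc k) - s k) where

  private
    step : ∀ {a b} → + 0 ≤ a → a < b → b < τ * b - a
    step {a} {b} 0≤a a<b = begin-strict
      b                                ≡⟨ sym (ℤₚ.+-identityʳ b) ⟩
      b + + 0                          ≤⟨ ℤₚ.+-monoʳ-≤ b 0≤[τ-2]b ⟩
      b + (τ - + 2) * b                ≡⟨ sym (ℤₚ.+-identityʳ _) ⟩
      b + (τ - + 2) * b + + 0          <⟨ ℤₚ.+-monoʳ-< (b + (τ - + 2) * b) 0<b-a ⟩
      b + (τ - + 2) * b + (b - a)      ≡⟨ regroup τ a b ⟩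
      τ * b - a                        ∎
      where
      open ℤₚ.≤-Reasoning
      regroup : ∀ τ a b → b + (τ - + 2) * b + (b - a) ≡ τ * b - a
      regroup = solve-∀
      0≤b : + 0 ≤ b
      0≤b = ℤₚ.≤-trans 0≤a (ℤₚ.<⇒≤ a<b)
      0≤[τ-2]b : + 0 ≤ (τ - + 2) * b
      0≤[τ-2]b = subst (_≤ (τ - + 2) * b) (ℤₚ.*-zeroˡ b)
        (ℤₚ.*-monoʳ-≤-nonNeg b ⦃ nonNegative 0≤b ⦄ (ℤₚ.i≤j⇒0≤j-i τ≥2))
      0<b-a : + 0 < b - a
      0<b-a = subst (_< b - a) (ℤₚ.+-inverseʳ a) (ℤₚ.+-monoˡ-< (- a) a<b)

  nonNegative-increasing : ∀ k → + 0 ≤ s k × s k < s (suc k)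
  nonNegative-increasing zero = s₀≥0 , s₀<s₁
  nonNegative-increasing (suc k) with nonNegative-increasing k
  ... | 0≤sₖ , sₖ<sₖ₊₁ =
    ℤₚ.≤-trans 0≤sₖ (ℤₚ.<⇒≤ sₖ<sₖ₊₁) ,
    subst (s (suc k) <_) (sym (recurrence k)) (step 0≤sₖ sₖ<sₖ₊₁)

  strictlyIncreasing : ∀ {i j} → i ℕ.< j → s i < s j
  strictlyIncreasing {i} {suc j} (s≤s i≤j) with ℕₚ.m≤n⇒m<n∨m≡n i≤j
  ... | inj₁ i<j = ℤₚ.<-trans (strictlyIncreasing i<j) (proj₂ (nonNegative-increasing j))
  ... | inj₂ refl = proj₂ (nonNegative-increasing j)

FreeBelow : (ℕ → Set) → ℕ → Set
FreeBelow P h = ∀ t → 0 ℕ.< t → t ℕ.< h → ¬ P t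

freeBelow-extend : ∀ {P : ℕ → Set} → (∀ i j → P (i ℕ.+ j) → P j → P i) →
  ∀ {n h} → P n → n ℕ.< h ℕ.+ h → FreeBelow P h → FreeBelow P n
freeBelow-extend {P} cancel {n} {h} Pn n<2h free-h t 0<t t<n Pt with t ℕ.<? h
... | yes t<h = free-h t 0<t t<h Pt
... | no t≮h = free-h (n ℕ.∸ t) (ℕₚ.m<n⇒0<n∸m t<n) n-t<h
      (cancel (n ℕ.∸ t) t (subst P (sym (ℕₚ.m∸n+n≡m (ℕₚ.<⇒≤ t<n))) Pn) Pt)
  where
  n-t<h : n ℕ.∸ t ℕ.< h
  n-t<h = subst (n ℕ.∸ t ℕ.<_) (ℕₚ.m+n∸n≡m h t)
    (ℕₚ.∸-monoˡ-< (ℕₚ.<-≤-trans n<2h (ℕₚ.+-monoʳ-≤ h (ℕₚ.≮⇒≥ t≮h))) (ℕₚ.<⇒≤ t<n))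

-- The ring ℤ[ω]

-- The integer ring solver only abstracts over variables, not over the terms ωt D and ωn D, so each
-- coordinate identity is proved for arbitrary t and n and then instantiated.
module _ (D : ℕ) where
  ⊕-assoc : Associative (_⊕_ D)
  ⊕-assoc (a , b) (c , d) (e , f) = cong₂ _,_ (ℤₚ.+-assoc a c e) (ℤₚ.+-assoc b d f)

  ⊕-comm : Commutative (_⊕_ D)
  ⊕-comm (a , b) (c , d) = cong₂ _,_ (ℤₚ.+-comm a c) (ℤₚ.+-comm b d)

  ⊕-identityˡ : LeftIdentity (+ 0 , + 0) (_⊕_ D)
  ⊕-identityˡ (a , b) = cong₂ _,_ (ℤₚ.+-identityˡ a) (ℤₚ.+-identityˡ b)

  ⊕-inverseˡ : LeftInverse (+ 0 , + 0) (⊖_ D) (_⊕_ D)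
  ⊕-inverseˡ (a , b) = cong₂ _,_ (ℤₚ.+-inverseˡ a) (ℤₚ.+-inverseˡ b)

  ⊗-assoc : Associative (_⊗_ D)
  ⊗-assoc (a , b) (c , d) (e , f) =
    cong₂ _,_ (first a b c d e f (ωt D) (ωn D)) (second a b c d e f (ωt D) (ωn D))
    where
    first : ∀ a b c d e f t n →
      (a * c + b * d * n) * e + (a * d + b * c + b * d * t) * f * n ≡
      a * (c * e + d * f * n) + b * (c * f + d * e + d * f * t) * n
    first = solve-∀
    second : ∀ a b c d e f t n →
      (a * c + b * d * n) * f + (a * d + b * c + b * d * t) * e
        + (a * d + b * c + b * d * t) * f * t ≡
      a * (c * f + d * e + d * f * t) + b * (c * e + d * f * n)
        + b * (c * f + d * e + d * f * t) * t
    second = solve-∀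

  ⊗-comm : Commutative (_⊗_ D)
  ⊗-comm (a , b) (c , d) =
    cong₂ _,_ (first a b c d (ωn D)) (second a b c d (ωt D))
    where
    first : ∀ a b c d n → a * c + b * d * n ≡ c * a + d * b * n
    first = solve-∀
    second : ∀ a b c d t → a * d + b * c + b * d * t ≡ c * b + d * a + d * b * t
    second = solve-∀

  ⊗-identityˡ : LeftIdentity (one D) (_⊗_ D)
  ⊗-identityˡ (a , b) = cong₂ _,_ (first a b (ωn D)) (second a b (ωt D))
    where
    first : ∀ a b n → + 1 * a + + 0 * b * n ≡ a
    first = solve-∀
    second : ∀ a b t → + 1 * b + + 0 * a + + 0 * b * t ≡ b
    second = solve-∀

  ⊗-distribˡ-⊕ : (_⊗_ D) DistributesOverˡ (_⊕_ D)
  ⊗-distribˡ-⊕ (a , b) (c , d) (e , f) =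
    cong₂ _,_ (first a b c d e f (ωn D)) (second a b c d e f (ωt D))
    where
    first : ∀ a b c d e f n →
      a * (c + e) + b * (d + f) * n ≡ (a * c + b * d * n) + (a * e + b * f * n)
    first = solve-∀
    second : ∀ a b c d e f t →
      a * (d + f) + b * (c + e) + b * (d + f) * t ≡
      (a * d + b * c + b * d * t) + (a * f + b * e + b * f * t)
    second = solve-∀

  𝒪-isCommutativeRing : IsCommutativeRing (_⊕_ D) (_⊗_ D) (⊖_ D) (+ 0 , + 0) (one D)
  𝒪-isCommutativeRing = record
    { isRing = record
      { +-isAbelianGroup = record
        { isGroup = record
          { isMonoid = record
            { isSemigroup = record
              { isMagma = record { isEquivalence = isEquivalence ; ∙-cong = cong₂ (_⊕_ D) }
              ; assoc = ⊕-assoc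
              }
            ; identity = comm∧idˡ⇒id ⊕-comm ⊕-identityˡ
            }
          ; inverse = comm∧invˡ⇒inv ⊕-comm ⊕-inverseˡ
          ; ⁻¹-cong = cong (⊖_ D)
          }
        ; comm = ⊕-comm
        }
      ; *-cong = cong₂ (_⊗_ D)
      ; *-assoc = ⊗-assoc
      ; *-identity = comm∧idˡ⇒id ⊗-comm ⊗-identityˡ
      ; distrib = ⊗-distribˡ-⊕ , comm∧distrˡ⇒distrʳ ⊗-comm ⊗-distribˡ-⊕
      }
    ; *-comm = ⊗-comm
    }

𝒪-commutativeRing : ℕ → CommutativeRing 0ℓ 0ℓ
𝒪-commutativeRing D = record { isCommutativeRing = 𝒪-isCommutativeRing D }

module Notation (D : ℕ) where
  infixl 6 _⊞_ _⊟_
  infixl 7 _⊠_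

  _⊞_ _⊠_ _⊟_ : 𝒪 → 𝒪 → 𝒪
  _⊞_ = _⊕_ D
  _⊠_ = _⊗_ D
  x ⊟ y = x ⊞ ⊖_ D y

  𝟘 𝟙 : 𝒪
  𝟘 = + 0 , + 0
  𝟙 = one D

  [_] : ℤ → 𝒪
  [_] = fromℤ D

  infix 4 _≈_[mod_]
  _≈_[mod_] : 𝒪 → 𝒪 → ℕ → Set
  _≈_[mod_] = _≡_[mod_] D

  open CommutativeRing (𝒪-commutativeRing D) public using (*-identityʳ)
  open CommutativeRing (𝒪-commutativeRing D) using (semiring; commutativeSemiring)
  open Exp semiring public using (_^_; ^-homo-*; ^-assocʳ)
  open CommutativeExp commutativeSemiring public using (^-distrib-*)

  module 𝒪-Solver = RingSolver (fromCommutativeRing (𝒪-commutativeRing D)) (≡-dec _≟ℤ_ _≟ℤ_)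

-- Tr(a + bω) = 2a + b Tr(ω), and Tr(ω) = ωt D.
trace : ℕ → 𝒪 → ℤ
trace D (a , b) = + 2 * a + ωt D * b

module Coordinates (D : ℕ) where
  open Notation D
  open 𝒪-Solver using (solve; _:+_; _:-_; _:*_; con; _:=_)
  private
    N Tr : 𝒪 → ℤ
    N = norm D
    Tr = trace D
    t n : ℤ
    t = ωt D
    n = ωn D

  norm-⊠ : ∀ x y → N (x ⊠ y) ≡ N x * N y
  norm-⊠ (a , b) (c , d) = identity a b c d t n
    where
    identity : ∀ a b c d t n →
      (a * c + b * d * n) * (a * c + b * d * n)
        + t * (a * c + b * d * n) * (a * d + b * c + b * d * t)
        - n * (a * d + b * c + b * d * t) * (a * d + b * c + b * d * t)
      ≡ (a * a + t * a * b - n * b * b) * (c * c + t * c * d - n * d * d)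
    identity = solve-∀

  norm-[] : ∀ c → N [ c ] ≡ c * c
  norm-[] c = identity c t n
    where
    identity : ∀ c t n → c * c + t * c * + 0 - n * + 0 * + 0 ≡ c * c
    identity = solve-∀

  trace-𝟙 : Tr 𝟙 ≡ + 2
  trace-𝟙 = identity t
    where
    identity : ∀ t → + 2 * + 1 + t * + 0 ≡ + 2
    identity = solve-∀

  []-⊠ : ∀ c x → [ c ] ⊠ x ≡ (c * proj₁ x , c * proj₂ x)
  []-⊠ c (a , b) = cong₂ _,_ (first c a b n) (second c a b t)
    where
    first : ∀ c a b n → c * a + + 0 * b * n ≡ c * a
    first = solve-∀
    second : ∀ c a b t → c * b + + 0 * a + + 0 * b * t ≡ c * b
    second = solve-∀

  []-* : ∀ a b → [ a * b ] ≡ [ a ] ⊠ [ b ]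
  []-* a b = cong₂ _,_ (first a b n) (second a b t)
    where
    first : ∀ a b n → a * b ≡ a * b + + 0 * + 0 * n
    first = solve-∀
    second : ∀ a b t → + 0 ≡ a * + 0 + + 0 * b + + 0 * + 0 * t
    second = solve-∀

  []-⊠-cancel : ∀ c .{{_ : ℤ.NonZero c}} {v w} → [ c ] ⊠ v ≡ [ c ] ⊠ w → v ≡ w
  []-⊠-cancel c {v} {w} cv≡cw =
    cong₂ _,_ (ℤₚ.*-cancelˡ-≡ c _ _ (cong proj₁ coordinates)) (ℤₚ.*-cancelˡ-≡ c _ _ (cong proj₂ coordinates))
    where
    coordinates : (c * proj₁ v , c * proj₂ v) ≡ (c * proj₁ w , c * proj₂ w)
    coordinates = trans (sym ([]-⊠ c v)) (trans cv≡cw ([]-⊠ c w))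

  𝟙≢v⊞v : ∀ v → 𝟙 ≢ v ⊞ v
  𝟙≢v⊞v v 𝟙≡v⊞v = 1≢i+i (proj₁ v) (cong proj₁ 𝟙≡v⊞v)

  norm-⊟𝟙 : ∀ x → N (x ⊟ 𝟙) ≡ N x - Tr x + + 1
  norm-⊟𝟙 (a , b) = identity a b t n
    where
    identity : ∀ a b t n →
      (a + - + 1) * (a + - + 1) + t * (a + - + 1) * (b + - + 0) - n * (b + - + 0) * (b + - + 0)
      ≡ a * a + t * a * b - n * b * b - (+ 2 * a + t * b) + + 1
    identity = solve-∀

  cayley-hamilton : ∀ x → x ⊠ x ⊞ [ N x ] ≡ [ Tr x ] ⊠ x
  cayley-hamilton (a , b) = cong₂ _,_ (first a b t n) (second a b t n)
    where
    first : ∀ a b t n →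
      a * a + b * b * n + (a * a + t * a * b - n * b * b) ≡ (+ 2 * a + t * b) * a + + 0 * b * n
    first = solve-∀
    second : ∀ a b t n →
      a * b + b * a + b * b * t + + 0 ≡ (+ 2 * a + t * b) * b + + 0 * a + + 0 * b * t
    second = solve-∀

  norm-one⇒sum-inverse : ∀ {x y} → N x ≡ + 1 → x ⊠ y ≡ 𝟙 → x ⊞ y ≡ [ Tr x ]
  norm-one⇒sum-inverse {x} {y} Nx≡1 xy≡1 = begin
    x ⊞ y
      ≡⟨ solve 2 (λ x y → x :+ y := y :* (x :* x :+ con 𝟙) :+ x :- x :* (x :* y)) refl x y ⟩
    y ⊠ (x ⊠ x ⊞ 𝟙) ⊞ x ⊟ x ⊠ (x ⊠ y)
      ≡⟨ cong₂ (λ p q → y ⊠ p ⊞ x ⊟ x ⊠ q) x²+1≡τx xy≡1 ⟩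
    y ⊠ ([ Tr x ] ⊠ x) ⊞ x ⊟ x ⊠ 𝟙
      ≡⟨ solve 3 (λ c x y → y :* (c :* x) :+ x :- x :* con 𝟙 := c :* (x :* y)) refl [ Tr x ] x y ⟩
    [ Tr x ] ⊠ (x ⊠ y)                   ≡⟨ cong ([ Tr x ] ⊠_) xy≡1 ⟩
    [ Tr x ] ⊠ 𝟙                         ≡⟨ *-identityʳ [ Tr x ] ⟩
    [ Tr x ]                             ∎
    where
    open ≡-Reasoning
    x²+1≡τx : x ⊠ x ⊞ 𝟙 ≡ [ Tr x ] ⊠ x
    x²+1≡τx = trans (cong (λ N → x ⊠ x ⊞ [ N ]) (sym Nx≡1)) (cayley-hamilton x)

  trace-recurrence : ∀ x y → Tr (x ⊠ (x ⊠ y)) ≡ Tr x * Tr (x ⊠ y) - N x * Tr y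
  trace-recurrence (a , b) (e , f) = identity a b e f t n
    where
    identity : ∀ a b e f t n →
      + 2 * (a * (a * e + b * f * n) + b * (a * f + b * e + b * f * t) * n)
        + t * (a * (a * f + b * e + b * f * t) + b * (a * e + b * f * n)
               + b * (a * f + b * e + b * f * t) * t)
      ≡ (+ 2 * a + t * b) * (+ 2 * (a * e + b * f * n) + t * (a * f + b * e + b * f * t))
        - (a * a + t * a * b - n * b * b) * (+ 2 * e + t * f)
    identity = solve-∀

  trace-square : ∀ x → Tr (x ⊠ x) ≡ Tr x * Tr x - + 2 * N x
  trace-square (a , b) = identity a b t n
    where
    identity : ∀ a b t n →
      + 2 * (a * a + b * b * n) + t * (a * b + b * a + b * b * t)
      ≡ (+ 2 * a + t * b) * (+ 2 * a + t * b) - + 2 * (a * a + t * a * b - n * b * b)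
    identity = solve-∀

  four-norm : ∀ x → + 4 * N x ≡ Tr x * Tr x - (t * t + + 4 * n) * (proj₂ x * proj₂ x)
  four-norm (a , b) = identity a b t n
    where
    identity : ∀ a b t n →
      + 4 * (a * a + t * a * b - n * b * b)
      ≡ (+ 2 * a + t * b) * (+ 2 * a + t * b) - (t * t + + 4 * n) * (b * b)
    identity = solve-∀

module Roots (D : ℕ) where
  open Notation D
  open 𝒪-Solver using (Polynomial; solve; _:+_; _:-_; _:*_; _:^_; con; _:=_)

  IsRoot : 𝒪 → 𝒪 → Set
  IsRoot d x = x ⊠ x ⊟ (d ⊟ 𝟙) ⊠ x ⊞ 𝟙 ≡ 𝟘

  inverse-isRoot : ∀ {x y} → x ⊠ y ≡ 𝟙 → IsRoot (𝟙 ⊞ x ⊞ y) x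
  inverse-isRoot {x} {y} xy≡1 = begin
    x ⊠ x ⊟ (𝟙 ⊞ x ⊞ y ⊟ 𝟙) ⊠ x ⊞ 𝟙
      ≡⟨ solve 2 (λ x y → x :* x :- (con 𝟙 :+ x :+ y :- con 𝟙) :* x :+ con 𝟙 := con 𝟙 :- x :* y) refl x y ⟩
    𝟙 ⊟ x ⊠ y                         ≡⟨ cong (𝟙 ⊟_) xy≡1 ⟩
    𝟙 ⊟ 𝟙                             ≡⟨ solve 0 (con 𝟙 :- con 𝟙 := con 𝟘) refl ⟩
    𝟘                                 ∎
    where open ≡-Reasoning

  private
    root-polynomial : ∀ {k} → Polynomial k → Polynomial k → Polynomial k
    root-polynomial d x = x :* x :- (d :- con 𝟙) :* x :+ con 𝟙

    reduce-mod-root : ∀ {d x} A B C → IsRoot d x →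
      A ≡ B ⊞ C ⊠ (x ⊠ x ⊟ (d ⊟ 𝟙) ⊠ x ⊞ 𝟙) → A ≡ B
    reduce-mod-root {d} {x} A B C root A≡ = begin
      A                                    ≡⟨ A≡ ⟩
      B ⊞ C ⊠ (x ⊠ x ⊟ (d ⊟ 𝟙) ⊠ x ⊞ 𝟙)     ≡⟨ cong (λ q → B ⊞ C ⊠ q) root ⟩
      B ⊞ C ⊠ 𝟘                            ≡⟨ solve 2 (λ B C → B :+ C :* con 𝟘 := B) refl B C ⟩
      B                                    ∎
      where open ≡-Reasoning

  isRoot⇒cube-minus-one : ∀ {d x} → IsRoot d x → x ^ 3 ⊟ 𝟙 ≡ d ⊠ (x ⊠ (x ⊟ 𝟙))
  isRoot⇒cube-minus-one {d} {x} root =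
    reduce-mod-root {d} {x} (x ^ 3 ⊟ 𝟙) (d ⊠ (x ⊠ (x ⊟ 𝟙))) (x ⊟ 𝟙) root
      (solve 2 (λ d x → x :^ 3 :- con 𝟙
                        := d :* (x :* (x :- con 𝟙)) :+ (x :- con 𝟙) :* root-polynomial d x)
             refl d x)

  isRoot⇒cube-plus-one : ∀ {d x} → IsRoot d x → x ^ 3 ⊞ 𝟙 ≡ (d ⊟ 𝟙 ⊟ 𝟙) ⊠ (x ⊠ (x ⊞ 𝟙))
  isRoot⇒cube-plus-one {d} {x} root =
    reduce-mod-root {d} {x} (x ^ 3 ⊞ 𝟙) ((d ⊟ 𝟙 ⊟ 𝟙) ⊠ (x ⊠ (x ⊞ 𝟙))) (x ⊞ 𝟙) root
      (solve 2 (λ d x → x :^ 3 :+ con 𝟙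
                        := (d :- con 𝟙 :- con 𝟙) :* (x :* (x :+ con 𝟙)) :+ (x :+ con 𝟙) :* root-polynomial d x)
             refl d x)

  isRoot⇒pronic : ∀ {d x} → IsRoot d x → x ⊠ (x ⊟ 𝟙) ≡ (d ⊟ 𝟙 ⊟ 𝟙) ⊠ x ⊟ 𝟙
  isRoot⇒pronic {d} {x} root =
    reduce-mod-root {d} {x} (x ⊠ (x ⊟ 𝟙)) ((d ⊟ 𝟙 ⊟ 𝟙) ⊠ x ⊟ 𝟙) 𝟙 root
      (solve 2 (λ d x → x :* (x :- con 𝟙)
                        := (d :- con 𝟙 :- con 𝟙) :* x :- con 𝟙 :+ con 𝟙 :* root-polynomial d x)
             refl d x)

  isRoot-even⇒sixth-power : ∀ {e x} → IsRoot (e ⊞ e) x →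
    (x ^ 3) ^ 2 ⊟ 𝟙 ≡ (e ⊞ e ⊞ (e ⊞ e)) ⊠ ((e ⊟ 𝟙) ⊠ (x ⊠ (x ⊟ 𝟙)) ⊠ (x ⊠ (x ⊞ 𝟙)))
  isRoot-even⇒sixth-power {e} {x} root = begin
    (x ^ 3) ^ 2 ⊟ 𝟙
      ≡⟨ solve 1 (λ y → y :^ 2 :- con 𝟙 := (y :- con 𝟙) :* (y :+ con 𝟙)) refl (x ^ 3) ⟩
    (x ^ 3 ⊟ 𝟙) ⊠ (x ^ 3 ⊞ 𝟙)
      ≡⟨ cong₂ _⊠_ (isRoot⇒cube-minus-one {e ⊞ e} {x} root)
                   (isRoot⇒cube-plus-one {e ⊞ e} {x} root) ⟩
    (e ⊞ e) ⊠ (x ⊠ (x ⊟ 𝟙)) ⊠ ((e ⊞ e ⊟ 𝟙 ⊟ 𝟙) ⊠ (x ⊠ (x ⊞ 𝟙)))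
      ≡⟨ solve 3 (λ e a b → (e :+ e) :* a :* ((e :+ e :- con 𝟙 :- con 𝟙) :* b)
                            := (e :+ e :+ (e :+ e)) :* ((e :- con 𝟙) :* a :* b))
               refl e (x ⊠ (x ⊟ 𝟙)) (x ⊠ (x ⊞ 𝟙)) ⟩
    (e ⊞ e ⊞ (e ⊞ e)) ⊠ ((e ⊟ 𝟙) ⊠ (x ⊠ (x ⊟ 𝟙)) ⊠ (x ⊠ (x ⊞ 𝟙)))
      ∎
    where open ≡-Reasoning

  isRoot-even⇒𝟙-even : ∀ {e x γ} → IsRoot (e ⊞ e) x → x ⊠ (x ⊟ 𝟙) ≡ γ ⊞ γ →
    𝟙 ≡ ((e ⊟ 𝟙) ⊠ x ⊟ γ) ⊞ ((e ⊟ 𝟙) ⊠ x ⊟ γ)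
  isRoot-even⇒𝟙-even {e} {x} {γ} root pronic≡γ+γ = begin
    𝟙
      ≡⟨ solve 2 (λ e x → con 𝟙
                          := (e :+ e :- con 𝟙 :- con 𝟙) :* x :- ((e :+ e :- con 𝟙 :- con 𝟙) :* x :- con 𝟙))
               refl e x ⟩
    (e ⊞ e ⊟ 𝟙 ⊟ 𝟙) ⊠ x ⊟ ((e ⊞ e ⊟ 𝟙 ⊟ 𝟙) ⊠ x ⊟ 𝟙)
      ≡⟨ cong ((e ⊞ e ⊟ 𝟙 ⊟ 𝟙) ⊠ x ⊟_)
              (trans (sym (isRoot⇒pronic {e ⊞ e} {x} root)) pronic≡γ+γ) ⟩
    (e ⊞ e ⊟ 𝟙 ⊟ 𝟙) ⊠ x ⊟ (γ ⊞ γ)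
      ≡⟨ solve 3 (λ e x γ → (e :+ e :- con 𝟙 :- con 𝟙) :* x :- (γ :+ γ)
                            := ((e :- con 𝟙) :* x :- γ) :+ ((e :- con 𝟙) :* x :- γ))
               refl e x γ ⟩
    ((e ⊟ 𝟙) ⊠ x ⊟ γ) ⊞ ((e ⊟ 𝟙) ⊠ x ⊟ γ)
      ∎
    where open ≡-Reasoning

module Periods (D : ℕ) where
  open Notation D
  open Coordinates D using ([]-*)
  open 𝒪-Solver using (solve; _:+_; _:-_; _:*_; con; _:=_)

  pow≡^ : ∀ x k → pow D x k ≡ x ^ k
  pow≡^ x zero = refl
  pow≡^ x (suc k) = cong (x ⊠_) (pow≡^ x k)

  𝟙^ : ∀ k → 𝟙 ^ k ≡ 𝟙
  𝟙^ zero = refl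
  𝟙^ (suc k) = trans (cong (𝟙 ⊠_) (𝟙^ k)) (⊗-identityˡ D 𝟙)

  ≈𝟙-cancel : ∀ m {a b} → a ⊠ b ≈ 𝟙 [mod m ] → b ≈ 𝟙 [mod m ] → a ≈ 𝟙 [mod m ]
  ≈𝟙-cancel m {a} {b} (γ , ab-1≡mγ) (δ , b-1≡mδ) = γ ⊟ a ⊠ δ , (begin
    a ⊟ 𝟙
      ≡⟨ solve 2 (λ a b → a :- con 𝟙 := (a :* b :- con 𝟙) :- a :* (b :- con 𝟙)) refl a b ⟩
    (a ⊠ b ⊟ 𝟙) ⊟ a ⊠ (b ⊟ 𝟙)
      ≡⟨ cong₂ (λ p q → p ⊟ a ⊠ q) ab-1≡mγ b-1≡mδ ⟩
    [ + m ] ⊠ γ ⊟ a ⊠ ([ + m ] ⊠ δ)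
      ≡⟨ solve 4 (λ M γ a δ → M :* γ :- a :* (M :* δ) := M :* (γ :- a :* δ)) refl [ + m ] γ a δ ⟩
    [ + m ] ⊠ (γ ⊟ a ⊠ δ)
      ∎)
    where open ≡-Reasoning

  ≈[mod*]⇒≈ : ∀ {α β} k m → α ≈ β [mod k ℕ.* m ] → α ≈ β [mod m ]
  ≈[mod*]⇒≈ {α} {β} k m (γ , α-β≡kmγ) = [ + k ] ⊠ γ , (begin
    α ⊟ β                     ≡⟨ α-β≡kmγ ⟩
    [ + (k ℕ.* m) ] ⊠ γ
      ≡⟨ cong (_⊠ γ) (trans (cong [_] (ℤₚ.pos-* k m)) ([]-* (+ k) (+ m))) ⟩
    [ + k ] ⊠ [ + m ] ⊠ γ
      ≡⟨ solve 3 (λ K M γ → K :* M :* γ := M :* (K :* γ)) refl [ + k ] [ + m ] γ ⟩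
    [ + m ] ⊠ ([ + k ] ⊠ γ)
      ∎)
    where open ≡-Reasoning

  Period : ℕ → 𝒪 → ℕ → Set
  Period m u j = u ^ j ≈ 𝟙 [mod m ]

  period-cancel : ∀ m u i j → Period m u (i ℕ.+ j) → Period m u j → Period m u i
  period-cancel m u i j Pi+j Pj =
    ≈𝟙-cancel m {u ^ i} {u ^ j} (subst (_≈ 𝟙 [mod m ]) (^-homo-* u i j) Pi+j) Pj

  isMulOrder : ∀ m u {k} → 0 ℕ.< k → Period m u k → FreeBelow (Period m u) k → IsMulOrder D m u k
  isMulOrder m u {k} 0<k Pk free = 0<k , to-pow k Pk , λ j 0<j Pj →
    ℕₚ.≮⇒≥ (λ j<k → free j 0<j j<k (from-pow j Pj))
    where
    to-pow : ∀ j → Period m u j → pow D u j ≈ 𝟙 [mod m ]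
    to-pow j = subst (_≈ 𝟙 [mod m ]) (sym (pow≡^ u j))
    from-pow : ∀ j → pow D u j ≈ 𝟙 [mod m ] → Period m u j
    from-pow j = subst (_≈ 𝟙 [mod m ]) (pow≡^ u j)

-- The unit u_D

discriminant : ∀ D → ωt D * ωt D + + 4 * ωn D ≡ (+ 2 - ωt D) * (+ 2 - ωt D) * + D
discriminant D with D % 4 ≡ᵇ 1 in D%4≡ᵇ1
... | false = identity (+ D)
  where
  identity : ∀ d → + 0 * + 0 + + 4 * d ≡ (+ 2 - + 0) * (+ 2 - + 0) * d
  identity = solve-∀
... | true = begin
  + 1 * + 1 + + 4 * + k   ≡⟨ cong (_+_ (+ 1)) (sym (ℤₚ.pos-* 4 k)) ⟩
  + (1 ℕ.+ 4 ℕ.* k)       ≡⟨ cong +_ (sym D≡1+4k) ⟩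
  + D                     ≡⟨ sym (ℤₚ.*-identityˡ (+ D)) ⟩
  (+ 2 - + 1) * (+ 2 - + 1) * + D ∎
  where
  open ≡-Reasoning
  k : ℕ
  k = (D ∸ 1) / 4
  D≡1+[D/4]*4 : D ≡ 1 ℕ.+ (D / 4) ℕ.* 4
  D≡1+[D/4]*4 = trans (m≡m%n+[m/n]*n D 4)
    (cong (ℕ._+ (D / 4) ℕ.* 4) (ℕₚ.≡ᵇ⇒≡ (D % 4) 1 (subst T (sym D%4≡ᵇ1) tt)))
  D≡1+4k : D ≡ 1 ℕ.+ 4 ℕ.* k
  D≡1+4k = trans D≡1+[D/4]*4 (cong (1 ℕ.+_) (trans (ℕₚ.*-comm (D / 4) 4)
    (cong (4 ℕ.*_) (sym (trans (cong (λ m → (m ∸ 1) / 4) D≡1+[D/4]*4) (m*n/n≡m (D / 4) 4))))))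

posSurd⇒positive : ∀ {D X Y} → 0 ℕ.< D → Y * Y * + D ≡ X * X + + 4 * X → PosSurd D X Y → + 0 < X
posSurd⇒positive {D} {X} {Y} 0<D Y²D≡X²+4X (inj₁ (0≤X , _ , not-both-zero)) with X ≟ℤ + 0
... | no X≢0 = ℤₚ.≤∧≢⇒< 0≤X (λ 0≡X → X≢0 (sym 0≡X))
... | yes refl = ⊥-elim (not-both-zero (refl , Y≡0))
  where
  Y≡0 : Y ≡ + 0
  Y≡0 with ℤₚ.i*j≡0⇒i≡0∨j≡0 (Y * Y) Y²D≡X²+4X
  ... | inj₂ D≡0 = ⊥-elim (ℕₚ.<⇒≢ 0<D (sym (ℤₚ.+-injective D≡0)))
  ... | inj₁ Y²≡0 with ℤₚ.i*j≡0⇒i≡0∨j≡0 Y Y²≡0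
  ...   | inj₁ Y≡0 = Y≡0
  ...   | inj₂ Y≡0 = Y≡0
posSurd⇒positive _ _ (inj₂ (inj₁ (0<X , _))) = 0<X
posSurd⇒positive {D} {X} {Y} _ Y²D≡X²+4X (inj₂ (inj₂ (_ , _ , X²<Y²D))) =
  ℤₚ.*-cancelˡ-<-nonNeg (+ 4) (begin-strict
    + 0                             ≡⟨ sym (ℤₚ.+-inverseˡ (X * X)) ⟩
    - (X * X) + X * X               <⟨ ℤₚ.+-monoʳ-< (- (X * X)) X²<Y²D ⟩
    - (X * X) + Y * Y * + D         ≡⟨ cong (_+_ (- (X * X))) Y²D≡X²+4X ⟩
    - (X * X) + (X * X + + 4 * X)   ≡⟨ cancel X (+ 4 * X) ⟩
    + 4 * X                         ∎)
  where
  open ℤₚ.≤-Reasoning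
  cancel : ∀ X z → - (X * X) + (X * X + z) ≡ z
  cancel = solve-∀

module FundamentalUnit (D : ℕ) where
  open Notation D
  open Coordinates D
  private
    t n : ℤ
    t = ωt D
    n = ωn D

  norm-one⇒trace≥3 : 0 ℕ.< D → ∀ {u} → norm D u ≡ + 1 → GreaterThanOne D u → + 3 ≤ trace D u
  norm-one⇒trace≥3 0<D {a , b} Nu≡1 u>1 = subst (+ 3 ≤_) (sym τ≡X+2)
    (ℤₚ.+-monoˡ-≤ (+ 2) (ℤₚ.i<j⇒suc[i]≤j (posSurd⇒positive 0<D Y²D≡X²+4X u>1)))
    where
    open ≡-Reasoning
    -- 2(u − 1) = X + Y√D under the real embedding, and N(u) = 1 reads Y²D = X² + 4X.
    τ X Y : ℤ
    τ = trace D (a , b)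
    X = + 2 * (a + - + 1) + t * (b + - + 0)
    Y = (+ 2 - t) * (b + - + 0)
    τ≡X+2 : τ ≡ X + + 2
    τ≡X+2 = identity a b t
      where
      identity : ∀ a b t → + 2 * a + t * b ≡ + 2 * (a + - + 1) + t * (b + - + 0) + + 2
      identity = solve-∀
    Y²D≡X²+4X : Y * Y * + D ≡ X * X + + 4 * X
    Y²D≡X²+4X = begin
      Y * Y * + D                                   ≡⟨ regroup a b t (+ D) ⟩
      (+ 2 - t) * (+ 2 - t) * + D * (b * b)         ≡⟨ cong (_* (b * b)) (sym (discriminant D)) ⟩
      (t * t + + 4 * n) * (b * b)                   ≡⟨ solve-for-Q τ _ ⟩
      τ * τ - (τ * τ - (t * t + + 4 * n) * (b * b)) ≡⟨ cong (_-_ (τ * τ)) (sym (four-norm (a , b))) ⟩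
      τ * τ - + 4 * norm D (a , b)                  ≡⟨ cong (λ N → τ * τ - + 4 * N) Nu≡1 ⟩
      τ * τ - + 4 * + 1                             ≡⟨ cong (λ τ → τ * τ - + 4 * + 1) τ≡X+2 ⟩
      (X + + 2) * (X + + 2) - + 4 * + 1             ≡⟨ expand X ⟩
      X * X + + 4 * X                               ∎
      where
      regroup : ∀ a b t D →
        (+ 2 - t) * (b + - + 0) * ((+ 2 - t) * (b + - + 0)) * D ≡ (+ 2 - t) * (+ 2 - t) * D * (b * b)
      regroup = solve-∀
      solve-for-Q : ∀ τ Q → Q ≡ τ * τ - (τ * τ - Q)
      solve-for-Q = solve-∀
      expand : ∀ X → (X + + 2) * (X + + 2) - + 4 * + 1 ≡ X * X + + 4 * X
      expand = solve-∀

  norm-minus-one⇒trace≥3 : 2 ℕ.≤ D → SquareFree D →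
    ∀ {v} → norm D v ≡ -[1+ 0 ] → + 3 ≤ trace D (v ⊠ v)
  norm-minus-one⇒trace≥3 2≤D squareFree {a , b} Nv≡-1 =
    subst (+ 3 ≤_) (sym trace-v²) (ℤₚ.+-monoˡ-≤ (+ 2) (i≢0⇒1≤i*i τ τ≢0))
    where
    open ≡-Reasoning
    τ : ℤ
    τ = trace D (a , b)
    trace-v² : trace D ((a , b) ⊠ (a , b)) ≡ τ * τ + + 2
    trace-v² = trans (trace-square (a , b)) (cong (λ N → τ * τ - + 2 * N) Nv≡-1)
    τ≢0 : τ ≢ + 0
    τ≢0 τ≡0 = squareFree⇒≢4 2≤D squareFree ((+ 2 - t) * b) (ℤₚ.neg-injective (begin
      - ((+ 2 - t) * b * ((+ 2 - t) * b) * + D)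
        ≡⟨ regroup b t (+ D) ⟩
      + 0 * + 0 - (+ 2 - t) * (+ 2 - t) * + D * (b * b)
        ≡⟨ cong₂ (λ τ Q → τ * τ - Q * (b * b)) (sym τ≡0) (sym (discriminant D)) ⟩
      τ * τ - (t * t + + 4 * n) * (b * b)
        ≡⟨ sym (four-norm (a , b)) ⟩
      + 4 * norm D (a , b)
        ≡⟨ cong (+ 4 *_) Nv≡-1 ⟩
      - + 4
        ∎))
      where
      regroup : ∀ b t D →
        - ((+ 2 - t) * b * ((+ 2 - t) * b) * D) ≡ + 0 * + 0 - (+ 2 - t) * (+ 2 - t) * D * (b * b)
      regroup = solve-∀

  unit-norm : ∀ {v} → IsUnit D v → norm D v ≡ + 1 ⊎ norm D v ≡ -[1+ 0 ]
  unit-norm {v} (w , vw≡1) = i*j≡1⇒i≡±1 (norm D v) (norm D w)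
    (trans (sym (norm-⊠ v w)) (trans (cong (norm D) vw≡1) (norm-[] (+ 1))))

  uD-norm-trace : 2 ℕ.≤ D → SquareFree D → ∀ {uf} → IsFundamentalUnit D uf →
    norm D (uD D uf) ≡ + 1 × + 3 ≤ trace D (uD D uf)
  uD-norm-trace 2≤D squareFree {uf} (isUnit , uf>1 , _) =
    by-sign (norm D uf ≟ℤ -[1+ 0 ]) (unit-norm {uf} isUnit)
    where
    by-sign : (N≟-1 : Dec (norm D uf ≡ -[1+ 0 ])) → norm D uf ≡ + 1 ⊎ norm D uf ≡ -[1+ 0 ] →
      let v = if does N≟-1 then uf ⊠ uf else uf in norm D v ≡ + 1 × + 3 ≤ trace D v
    by-sign (yes N≡-1) _ =
      trans (norm-⊠ uf uf) (cong₂ _*_ N≡-1 N≡-1) , norm-minus-one⇒trace≥3 2≤D squareFree {uf} N≡-1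
    by-sign (no _) (inj₁ N≡1) = N≡1 , norm-one⇒trace≥3 (ℕₚ.<-≤-trans (s≤s z≤n) 2≤D) {uf} N≡1 uf>1
    by-sign (no N≢-1) (inj₂ N≡-1) = ⊥-elim (N≢-1 N≡-1)

-- The order of u_D

module UnitOrder (D : ℕ) {u ũ : 𝒪} (norm-u : norm D u ≡ + 1) (trace-u≥3 : + 3 ≤ trace D u)
  (uũ≡1 : _⊗_ D u ũ ≡ one D) {r : ℕ} (r≥1 : 1 ℕ.≤ r) {d : ℕ}
  (d≡1+uʳ+ũʳ : fromℤ D (+ d) ≡ _⊕_ D (_⊕_ D (one D) (pow D u r)) (pow D ũ r)) where
  open Notation D
  open Coordinates D
  open Roots D
  open Periods D
  open 𝒪-Solver using (solve; _:+_; _:*_; _:=_)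

  x x̃ : 𝒪
  x = u ^ r
  x̃ = ũ ^ r

  d≡1+x+x̃ : [ + d ] ≡ 𝟙 ⊞ x ⊞ x̃
  d≡1+x+x̃ = trans d≡1+uʳ+ũʳ (cong₂ (λ p q → 𝟙 ⊞ p ⊞ q) (pow≡^ u r) (pow≡^ ũ r))

  xx̃≡1 : x ⊠ x̃ ≡ 𝟙
  xx̃≡1 = trans (sym (^-distrib-* u ũ r)) (trans (cong (_^ r) uũ≡1) (𝟙^ r))

  x-root : IsRoot [ + d ] x
  x-root = subst (λ c → IsRoot c x) (sym d≡1+x+x̃) (inverse-isRoot {x} {x̃} xx̃≡1)

  norm-u^ : ∀ k → norm D (u ^ k) ≡ + 1
  norm-u^ zero = norm-[] (+ 1)
  norm-u^ (suc k) = trans (norm-⊠ u (u ^ k)) (cong₂ _*_ norm-u (norm-u^ k))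

  trace-x : trace D x ≡ + d - + 1
  trace-x = begin
    trace D x                    ≡⟨ identity (trace D x) ⟩
    + 1 + trace D x - + 1        ≡⟨ cong (λ c → proj₁ c - + 1) (sym [d]≡1+[τ]) ⟩
    + d - + 1                    ∎
    where
    open ≡-Reasoning
    identity : ∀ τ → τ ≡ + 1 + τ - + 1
    identity = solve-∀
    [d]≡1+[τ] : [ + d ] ≡ 𝟙 ⊞ [ trace D x ]
    [d]≡1+[τ] = trans d≡1+x+x̃ (trans (⊕-assoc D 𝟙 x x̃)
      (cong (𝟙 ⊞_) (norm-one⇒sum-inverse {x} {x̃} (norm-u^ r) xx̃≡1)))

  s : ℕ → ℤ
  s k = trace D (u ^ k)

  s₀≡2 : s 0 ≡ + 2
  s₀≡2 = trace-𝟙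

  open Lucas {s} {trace D u}
    (ℤₚ.≤-trans (+≤+ (s≤s (s≤s z≤n))) trace-u≥3)
    (subst (+ 0 ≤_) (sym s₀≡2) (+≤+ z≤n))
    (subst₂ _<_ (sym s₀≡2) (sym (cong (trace D) (*-identityʳ u))) (ℤₚ.suc[i]≤j⇒i<j trace-u≥3))
    (λ k → trans (trace-recurrence u (u ^ k))
      (cong (_-_ (trace D u * s (suc k))) (trans (cong (_* s k) norm-u) (ℤₚ.*-identityˡ (s k)))))
    using (strictlyIncreasing)

  s-2r : s (r ℕ.+ r) ≡ (+ d - + 1) * (+ d - + 1) - + 2
  s-2r = begin
    trace D (u ^ (r ℕ.+ r))               ≡⟨ cong (trace D) (^-homo-* u r r) ⟩
    trace D (x ⊠ x)                       ≡⟨ trace-square x ⟩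
    trace D x * trace D x - + 2 * norm D x ≡⟨ cong₂ (λ τ N → τ * τ - + 2 * N) trace-x (norm-u^ r) ⟩
    (+ d - + 1) * (+ d - + 1) - + 2 * + 1  ≡⟨⟩
    (+ d - + 1) * (+ d - + 1) - + 2        ∎
    where open ≡-Reasoning

  u^3r≡x^3 : u ^ (3 ℕ.* r) ≡ x ^ 3
  u^3r≡x^3 = trans (cong (u ^_) (ℕₚ.*-comm 3 r)) (sym (^-assocʳ u r 3))

  period-3r : Period d u (3 ℕ.* r)
  period-3r = x ⊠ (x ⊟ 𝟙) , (begin
    u ^ (3 ℕ.* r) ⊟ 𝟙            ≡⟨ cong (_⊟ 𝟙) u^3r≡x^3 ⟩
    x ^ 3 ⊟ 𝟙                    ≡⟨ isRoot⇒cube-minus-one {[ + d ]} {x} x-root ⟩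
    [ + d ] ⊠ (x ⊠ (x ⊟ 𝟙))      ∎)
    where open ≡-Reasoning

  no-period-below-2r : FreeBelow (Period d u) (r ℕ.+ r)
  no-period-below-2r t 0<t t<2r (γ , uᵗ-1≡dγ) =
    ℤₚ.<-irrefl refl (ℤₚ.<-≤-trans (ℤₚ.≤-<-trans d²≤sₜ-2 sₜ-2<[d-1]²-4) ([n-1]²-4≤n² d))
    where
    open ≡-Reasoning
    sₜ-2≡d²g : s t - + 2 ≡ + d * + d * - norm D γ
    sₜ-2≡d²g = begin
      s t - + 2                        ≡⟨ identity (s t) ⟩
      - (+ 1 - s t + + 1)              ≡⟨ cong (λ N → - (N - s t + + 1)) (sym (norm-u^ t)) ⟩
      - (norm D (u ^ t) - s t + + 1)   ≡⟨ cong -_ (sym (norm-⊟𝟙 (u ^ t))) ⟩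
      - norm D (u ^ t ⊟ 𝟙)             ≡⟨ cong (λ y → - norm D y) uᵗ-1≡dγ ⟩
      - norm D ([ + d ] ⊠ γ)           ≡⟨ cong -_ (trans (norm-⊠ [ + d ] γ) (cong (_* norm D γ) (norm-[] (+ d)))) ⟩
      - (+ d * + d * norm D γ)         ≡⟨ ℤₚ.neg-distribʳ-* (+ d * + d) (norm D γ) ⟩
      + d * + d * - norm D γ           ∎
      where
      identity : ∀ s → s - + 2 ≡ - (+ 1 - s + + 1)
      identity = solve-∀
    2<sₜ : + 2 < s t
    2<sₜ = subst (_< s t) s₀≡2 (strictlyIncreasing 0<t)
    0<sₜ-2 : + 0 < s t - + 2
    0<sₜ-2 = subst (_< s t - + 2) (ℤₚ.+-inverseʳ (+ 2)) (ℤₚ.+-monoˡ-< (- + 2) 2<sₜ)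
    d²≤sₜ-2 : + d * + d ≤ s t - + 2
    d²≤sₜ-2 = subst (+ d * + d ≤_) (sym sₜ-2≡d²g)
      (≤-positive-multiple (+ d * + d) (- norm D γ) (subst (+ 0 ≤_) (ℤₚ.pos-* d d) (+≤+ z≤n))
        (subst (+ 0 <_) sₜ-2≡d²g 0<sₜ-2))
    sₜ-2<[d-1]²-4 : s t - + 2 < (+ d - + 1) * (+ d - + 1) - + 4
    sₜ-2<[d-1]²-4 = subst (s t - + 2 <_) (identity (+ d))
      (ℤₚ.+-monoˡ-< (- + 2) (subst (s t <_) s-2r (strictlyIncreasing t<2r)))
      where
      identity : ∀ d → (d - + 1) * (d - + 1) - + 2 - + 2 ≡ (d - + 1) * (d - + 1) - + 4
      identity = solve-∀

  0<d : 0 ℕ.< d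
  0<d = ℕₚ.n≢0⇒n>0 (λ d≡0 → 2≮-1 (subst (λ m → + 2 < + m - + 1) d≡0 2<d-1))
    where
    2<d-1 : + 2 < + d - + 1
    2<d-1 = subst (+ 2 <_) trace-x (subst (_< s r) s₀≡2 (strictlyIncreasing r≥1))
    2≮-1 : ¬ (+ 2 < -[1+ 0 ])
    2≮-1 ()

  0<3r : 0 ℕ.< 3 ℕ.* r
  0<3r = ℕₚ.<-≤-trans r≥1 (ℕₚ.m≤m+n r _)

  no-period-below-3r : FreeBelow (Period d u) (3 ℕ.* r)
  no-period-below-3r =
    freeBelow-extend {Period d u} (period-cancel d u) period-3r 3r<4r no-period-below-2r
    where
    3r<4r : 3 ℕ.* r ℕ.< r ℕ.+ r ℕ.+ (r ℕ.+ r)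
    3r<4r = subst (3 ℕ.* r ℕ.<_) (four-times r)
      (ℕₚ.*-monoˡ-< r ⦃ ℕ.>-nonZero r≥1 ⦄ (ℕₚ.n<1+n 3))
      where
      four-times : ∀ r → 4 ℕ.* r ≡ r ℕ.+ r ℕ.+ (r ℕ.+ r)
      four-times = ℕ-solve-∀

  order-mod-d : IsMulOrder D d u (3 ℕ.* r)
  order-mod-d = isMulOrder d u 0<3r period-3r no-period-below-3r

  module _ {e : ℕ} (d≡e+e : d ≡ e ℕ.+ e) where
    private
      E : 𝒪
      E = [ + e ]

    [d]≡E⊞E : [ + d ] ≡ E ⊞ E
    [d]≡E⊞E = cong [_] (trans (cong +_ d≡e+e) (ℤₚ.pos-+ e e))

    [2d]≡[d]⊞[d] : [ + (2 ℕ.* d) ] ≡ [ + d ] ⊞ [ + d ]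
    [2d]≡[d]⊞[d] = cong [_] (trans (cong (λ m → + (d ℕ.+ m)) (ℕₚ.+-identityʳ d)) (ℤₚ.pos-+ d d))

    x-root-even : IsRoot (E ⊞ E) x
    x-root-even = subst (λ c → IsRoot c x) [d]≡E⊞E x-root

    period-6r : Period (2 ℕ.* d) u (3 ℕ.* r ℕ.* 2)
    period-6r = W , (begin
      u ^ (3 ℕ.* r ℕ.* 2) ⊟ 𝟙    ≡⟨ cong (_⊟ 𝟙) (sym (^-assocʳ u (3 ℕ.* r) 2)) ⟩
      (u ^ (3 ℕ.* r)) ^ 2 ⊟ 𝟙    ≡⟨ cong (λ y → y ^ 2 ⊟ 𝟙) u^3r≡x^3 ⟩
      (x ^ 3) ^ 2 ⊟ 𝟙            ≡⟨ isRoot-even⇒sixth-power {E} {x} x-root-even ⟩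
      (E ⊞ E ⊞ (E ⊞ E)) ⊠ W      ≡⟨ cong (_⊠ W) (sym [2d]≡4E) ⟩
      [ + (2 ℕ.* d) ] ⊠ W        ∎)
      where
      open ≡-Reasoning
      W : 𝒪
      W = (E ⊟ 𝟙) ⊠ (x ⊠ (x ⊟ 𝟙)) ⊠ (x ⊠ (x ⊞ 𝟙))
      [2d]≡4E : [ + (2 ℕ.* d) ] ≡ E ⊞ E ⊞ (E ⊞ E)
      [2d]≡4E = trans [2d]≡[d]⊞[d] (cong₂ _⊞_ [d]≡E⊞E [d]≡E⊞E)

    not-period-3r : ¬ Period (2 ℕ.* d) u (3 ℕ.* r)
    not-period-3r (γ , u³ʳ-1≡2dγ) =
      𝟙≢v⊞v ((E ⊟ 𝟙) ⊠ x ⊟ γ) (isRoot-even⇒𝟙-even {E} {x} {γ} x-root-even pronic≡γ+γ)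
      where
      open ≡-Reasoning
      pronic≡γ+γ : x ⊠ (x ⊟ 𝟙) ≡ γ ⊞ γ
      pronic≡γ+γ = []-⊠-cancel (+ d) ⦃ ℕ.>-nonZero 0<d ⦄ (begin
        [ + d ] ⊠ (x ⊠ (x ⊟ 𝟙))    ≡⟨ sym (isRoot⇒cube-minus-one {[ + d ]} {x} x-root) ⟩
        x ^ 3 ⊟ 𝟙                  ≡⟨ cong (_⊟ 𝟙) (sym u^3r≡x^3) ⟩
        u ^ (3 ℕ.* r) ⊟ 𝟙          ≡⟨ u³ʳ-1≡2dγ ⟩
        [ + (2 ℕ.* d) ] ⊠ γ        ≡⟨ cong (_⊠ γ) [2d]≡[d]⊞[d] ⟩
        ([ + d ] ⊞ [ + d ]) ⊠ γ    ≡⟨ solve 2 (λ c γ → (c :+ c) :* γ := c :* (γ :+ γ)) refl [ + d ] γ ⟩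
        [ + d ] ⊠ (γ ⊞ γ)          ∎)

    no-period-below-3r+1 : FreeBelow (Period (2 ℕ.* d) u) (suc (3 ℕ.* r))
    no-period-below-3r+1 t 0<t t≤3r with ℕₚ.m≤n⇒m<n∨m≡n (ℕ.s≤s⁻¹ t≤3r)
    ... | inj₁ t<3r = no-period-below-3r t 0<t t<3r ∘ ≈[mod*]⇒≈ {u ^ t} {𝟙} 2 d
    ... | inj₂ refl = not-period-3r

    order-mod-2d : IsMulOrder D (2 ℕ.* d) u (3 ℕ.* r ℕ.* 2)
    order-mod-2d = isMulOrder (2 ℕ.* d) u (ℕₚ.<-≤-trans 0<3r (ℕₚ.m≤m*n (3 ℕ.* r) 2)) period-6r
      (freeBelow-extend {Period (2 ℕ.* d) u} (period-cancel (2 ℕ.* d) u)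
        period-6r 6r<6r+2 no-period-below-3r+1)
      where
      6r<6r+2 : 3 ℕ.* r ℕ.* 2 ℕ.< suc (3 ℕ.* r) ℕ.+ suc (3 ℕ.* r)
      6r<6r+2 = subst (ℕ._< suc (3 ℕ.* r) ℕ.+ suc (3 ℕ.* r)) (sym (double (3 ℕ.* r)))
        (ℕₚ.+-mono-< (ℕₚ.n<1+n (3 ℕ.* r)) (ℕₚ.n<1+n (3 ℕ.* r)))
        where
        double : ∀ m → m ℕ.* 2 ≡ m ℕ.+ m
        double = ℕ-solve-∀

evenFactor-cases : ∀ d → evenFactor d ≡ 1 ⊎ (evenFactor d ≡ 2 × ∃[ e ] d ≡ e ℕ.+ e)
evenFactor-cases d with d % 2 ≡ᵇ 0 in d%2≡ᵇ0
... | false = inj₁ refl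
... | true = inj₂ (refl , d / 2 , d≡[d/2]+[d/2])
  where
  d≡[d/2]+[d/2] : d ≡ d / 2 ℕ.+ d / 2
  d≡[d/2]+[d/2] = begin
    d                     ≡⟨ m≡m%n+[m/n]*n d 2 ⟩
    d % 2 ℕ.+ d / 2 ℕ.* 2 ≡⟨ cong (ℕ._+ d / 2 ℕ.* 2) d%2≡0 ⟩
    d / 2 ℕ.* 2           ≡⟨ double (d / 2) ⟩
    d / 2 ℕ.+ d / 2       ∎
    where
    open ≡-Reasoning
    d%2≡0 : d % 2 ≡ 0
    d%2≡0 = ℕₚ.≡ᵇ⇒≡ (d % 2) 0 (subst T (sym d%2≡ᵇ0) tt)
    double : ∀ m → m ℕ.* 2 ≡ m ℕ.+ m
    double = ℕ-solve-∀

lemma2 : (D : ℕ) → 2 ℕ.≤ D → SquareFree D →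
         (uf : 𝒪) → IsFundamentalUnit D uf →
         (uinv : 𝒪) → _⊗_ D (uD D uf) uinv ≡ one D →
         (r : ℕ) → 1 ℕ.≤ r →
         (d : ℕ) →
         fromℤ D (+ d) ≡ _⊕_ D (_⊕_ D (one D) (pow D (uD D uf) r)) (pow D uinv r) →
         IsMulOrder D (dPrime d) (uD D uf) (3 ℕ.* r ℕ.* evenFactor d)
lemma2 D 2≤D squareFree uf isFundamental uinv u⊗uinv≡1 r r≥1 d d≡ = by-parity (evenFactor-cases d)
  where
  u : 𝒪
  u = uD D uf
  norm-trace : norm D u ≡ + 1 × + 3 ≤ trace D u
  norm-trace = FundamentalUnit.uD-norm-trace D 2≤D squareFree isFundamental
  open UnitOrder D (proj₁ norm-trace) (proj₂ norm-trace) u⊗uinv≡1 r≥1 d≡ using (order-mod-d; order-mod-2d)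

  Order : ℕ → Set
  Order f = IsMulOrder D (f ℕ.* d) u (3 ℕ.* r ℕ.* f)

  by-parity : evenFactor d ≡ 1 ⊎ (evenFactor d ≡ 2 × ∃[ e ] d ≡ e ℕ.+ e) → Order (evenFactor d)
  by-parity (inj₁ ef≡1) = subst Order (sym ef≡1)
    (subst₂ (λ m k → IsMulOrder D m u k) (sym (ℕₚ.*-identityˡ d)) (sym (ℕₚ.*-identityʳ (3 ℕ.* r))) order-mod-d)
  by-parity (inj₂ (ef≡2 , e , d≡e+e)) = subst Order (sym ef≡2) (order-mod-2d {e} d≡e+e)
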